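{- Let $\mathbf P=(P,\leq)$ be a poset, $a,b\in P$ with $a\leq b$, $x\in[a,b]$ and $y\in P$, and assume that $e$ is the greatest element of $L\big(U(a,y),b\big)$ and $f$ is the smallest element of $U\big(a,L(y,b)\big)$. Then $a\leq f\leq e\leq b$, and the following are equivalent: (i) $e,f\in R(a,b,x)$; (ii) $L\big(U(a,y),x\big)=L(a)$ and $U\big(x,L(y,b)\big)=U(b)$.
   Context: In a poset $(P,\leq)$, for $A\subseteq P$ let $L(A)=\{p\in P\mid p\leq a\text{ for all }a\in A\}$ and $U(A)=\{p\in P\mid a\leq p\text{ for all }a\in A\}$. One writes $L(a)$ for $L(\{a\})$, $L(a,b)$ for $L(\{a,b\})$, $L(A,a)$ for $L(A\cup\{a\})$, and similarly for $U$; e.g. $L\big(U(a,y),b\big)=L\big(U(\{a,y\})\cup\{b\}\big)$ and $U\big(a,L(y,b)\big)=U\big(\{a\}\cup L(\{y,b\})\big)$. For $a\leq b$ and $x\in[a,b]$, an element $z\in[a,b]$ is a relative complement of $x$ in $[a,b]$ if $U(x,z)=U(b)$ and $L(x,z)=L(a)$; $R(a,b,x)$ denotes the set of all such relative complements. -}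

module Defs where

open import Level using (Level; _⊔_; suc)
open import Data.Product using (_×_; _,_)
open import Data.Sum using (_⊎_)
open import Relation.Binary.Bundles using (Poset)

module PosetNotions {c ℓ₁ ℓ₂ : Level} (P : Poset c ℓ₁ ℓ₂) where
  open Poset P

  Subset : Set (suc (c ⊔ ℓ₁ ⊔ ℓ₂))
  Subset = Carrier → Set (c ⊔ ℓ₁ ⊔ ℓ₂)

  sing : Carrier → Subset
  sing a p = Level.Lift (c ⊔ ℓ₂) (p ≈ a)

  pair : Carrier → Carrier → Subset
  pair a b p = Level.Lift (c ⊔ ℓ₂) (p ≈ a) ⊎ Level.Lift (c ⊔ ℓ₂) (p ≈ b)

  _∪_ : Subset → Subset → Subset
  (A ∪ B) p = A p ⊎ B p

  L : Subset → Subset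
  L A p = ∀ q → A q → p ≤ q

  U : Subset → Subset
  U A p = ∀ q → A q → q ≤ p

  _≐_ : Subset → Subset → Set (c ⊔ ℓ₁ ⊔ ℓ₂)
  A ≐ B = ∀ p → (A p → B p) × (B p → A p)

  IsGreatest : Subset → Carrier → Set (c ⊔ ℓ₁ ⊔ ℓ₂)
  IsGreatest A e = A e × (∀ q → A q → q ≤ e)

  IsSmallest : Subset → Carrier → Set (c ⊔ ℓ₁ ⊔ ℓ₂)
  IsSmallest A f = A f × (∀ q → A q → f ≤ q)

  InInterval : Carrier → Carrier → Carrier → Set ℓ₂
  InInterval a b x = a ≤ x × x ≤ b

  R : Carrier → Carrier → Carrier → Carrier → Set (c ⊔ ℓ₁ ⊔ ℓ₂)
  R a b x z = InInterval a b z × (U (pair x z) ≐ U (sing b)) × (L (pair x z) ≐ L (sing a))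

{-# OPTIONS --safe #-}
module Submission where

-- Inside x ≤ b, being a lower bound of U(a,y) means being below e, so
-- L(U(a,y),x) = L(x,e); dually U(x,L(y,b)) = U(x,f).  Condition (ii) thus says
-- that x and e have "meet" a and x and f have "join" b.  Since f ≤ e, the join of
-- x and e is then also b, and the meet of x and f is also a, which is (i).

open import Defs
open import Level using (Level; lift)
open import Data.Product using (_×_; _,_; proj₁; proj₂; map₂)
open import Data.Sum using (inj₁; inj₂; [_,_])
open import Function.Base using (_∘_)
open import Function.Bundles using (_⇔_; mk⇔; Equivalence)
import Function.Properties.Equivalence as ⇔
open import Data.Product.Function.NonDependent.Propositional using (_×-⇔_)
open import Relation.Binary.Bundles using (Poset)

module Cones {c ℓ₁ ℓ₂ : Level} (P : Poset c ℓ₁ ℓ₂) where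
  open Poset P using (refl; reflexive; trans; module Eq) renaming (_≤_ to _⊑_)
  open PosetNotions P using (Subset; sing; pair; _∪_; L; U; _≐_; IsGreatest; IsSmallest; R)
  open Equivalence using (to; from)

  ≐-sym : {A B : Subset} → A ≐ B → B ≐ A
  ≐-sym A≐B p = proj₂ (A≐B p) , proj₁ (A≐B p)

  ≐-trans : {A B D : Subset} → A ≐ B → B ≐ D → A ≐ D
  ≐-trans A≐B B≐D p = proj₁ (B≐D p) ∘ proj₁ (A≐B p) , proj₂ (A≐B p) ∘ proj₂ (B≐D p)

  ≐-substˡ : {A A′ B : Subset} → A ≐ A′ → (A ≐ B) ⇔ (A′ ≐ B)
  ≐-substˡ A≐A′ = mk⇔ (≐-trans (≐-sym A≐A′)) (≐-trans A≐A′)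

  ⇔⇒≐ : {A B : Subset} → (∀ p → A p ⇔ B p) → A ≐ B
  ⇔⇒≐ A⇔B p = to (A⇔B p) , from (A⇔B p)

  sing-refl : ∀ {a} → sing a a
  sing-refl = lift Eq.refl

  pair-left : ∀ {a y} → pair a y a
  pair-left = inj₁ sing-refl

  pair-right : ∀ {a y} → pair a y y
  pair-right = inj₂ sing-refl

  L-sing : ∀ {a p} → L (sing a) p ⇔ p ⊑ a
  L-sing = mk⇔ (λ h → h _ sing-refl) (λ p⊑a q (lift q≈a) → trans p⊑a (reflexive (Eq.sym q≈a)))

  U-sing : ∀ {a p} → U (sing a) p ⇔ a ⊑ p
  U-sing = mk⇔ (λ h → h _ sing-refl) (λ a⊑p q (lift q≈a) → trans (reflexive q≈a) a⊑p)

  L-∪ : ∀ {A B p} → L (A ∪ B) p ⇔ (L A p × L B p)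
  L-∪ = mk⇔ (λ h → (λ q → h q ∘ inj₁) , (λ q → h q ∘ inj₂))
            (λ (hA , hB) q → [ hA q , hB q ])

  U-∪ : ∀ {A B p} → U (A ∪ B) p ⇔ (U A p × U B p)
  U-∪ = mk⇔ (λ h → (λ q → h q ∘ inj₁) , (λ q → h q ∘ inj₂))
            (λ (hA , hB) q → [ hA q , hB q ])

  L-pair : ∀ {x z p} → L (pair x z) p ⇔ (p ⊑ x × p ⊑ z)
  L-pair = ⇔.trans L-∪ (mk⇔ (λ (hx , hz) → to L-sing hx , to L-sing hz)
                           (λ (px , pz) → from L-sing px , from L-sing pz))

  U-pair : ∀ {x z p} → U (pair x z) p ⇔ (x ⊑ p × z ⊑ p)
  U-pair = ⇔.trans U-∪ (mk⇔ (λ (hx , hz) → to U-sing hx , to U-sing hz)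
                           (λ (xp , zp) → from U-sing xp , from U-sing zp))

  L-∪-sing : ∀ {A x p} → L (A ∪ sing x) p ⇔ (L A p × p ⊑ x)
  L-∪-sing = ⇔.trans L-∪ (mk⇔ (map₂ (to L-sing)) (map₂ (from L-sing)))

  U-sing-∪ : ∀ {A x p} → U (sing x ∪ A) p ⇔ (x ⊑ p × U A p)
  U-sing-∪ = ⇔.trans U-∪ (mk⇔ (λ (hx , hA) → to U-sing hx , hA)
                                 (λ (xp , hA) → from U-sing xp , hA))

  below-member⇒L-U : ∀ {A y p} → A y → p ⊑ y → L (U A) p
  below-member⇒L-U Ay p⊑y q h = trans p⊑y (h _ Ay)

  greatest-L-∪-sing-≤ : ∀ {A b e} → IsGreatest (L (A ∪ sing b)) e → e ⊑ b
  greatest-L-∪-sing-≤ (eL , _) = proj₂ (to L-∪-sing eL)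

  smallest-U-sing-∪-≥ : ∀ {A a f} → IsSmallest (U (sing a ∪ A)) f → a ⊑ f
  smallest-U-sing-∪-≥ (fU , _) = proj₁ (to U-sing-∪ fU)

  greatest-L-∪-sing : ∀ {A b e p} → IsGreatest (L (A ∪ sing b)) e → p ⊑ b → L A p ⇔ p ⊑ e
  greatest-L-∪-sing {p = p} (eL , eMax) p⊑b =
    mk⇔ (λ pL → eMax p (from L-∪-sing (pL , p⊑b)))
        (λ p⊑e q Aq → trans p⊑e (proj₁ (to L-∪-sing eL) q Aq))

  smallest-U-sing-∪ : ∀ {A a f p} → IsSmallest (U (sing a ∪ A)) f → a ⊑ p → U A p ⇔ f ⊑ p
  smallest-U-sing-∪ {p = p} (fU , fMin) a⊑p =
    mk⇔ (λ pU → fMin p (from U-sing-∪ (a⊑p , pU)))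
        (λ f⊑p q Aq → trans (proj₂ (to U-sing-∪ fU) q Aq) f⊑p)

  L-∪-sing≐L-pair : ∀ {A b e x} → IsGreatest (L (A ∪ sing b)) e → x ⊑ b →
                    L (A ∪ sing x) ≐ L (pair x e)
  L-∪-sing≐L-pair eG x⊑b = ⇔⇒≐ λ p → mk⇔
    (λ pL → let (pA , p⊑x) = to L-∪-sing pL
            in from L-pair (p⊑x , to (greatest-L-∪-sing eG (trans p⊑x x⊑b)) pA))
    (λ pL → let (p⊑x , p⊑e) = to L-pair pL
            in from L-∪-sing (from (greatest-L-∪-sing eG (trans p⊑x x⊑b)) p⊑e , p⊑x))

  U-sing-∪≐U-pair : ∀ {A a f x} → IsSmallest (U (sing a ∪ A)) f → a ⊑ x →
                    U (sing x ∪ A) ≐ U (pair x f)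
  U-sing-∪≐U-pair fS a⊑x = ⇔⇒≐ λ p → mk⇔
    (λ pU → let (x⊑p , pA) = to U-sing-∪ pU
            in from U-pair (x⊑p , to (smallest-U-sing-∪ fS (trans a⊑x x⊑p)) pA))
    (λ pU → let (x⊑p , f⊑p) = to U-pair pU
            in from U-sing-∪ (x⊑p , from (smallest-U-sing-∪ fS (trans a⊑x x⊑p)) f⊑p))

  L-pair⊆L-U-pair-∪-sing : ∀ {a y b p} → L (pair y b) p → L (U (pair a y) ∪ sing b) p
  L-pair⊆L-U-pair-∪-sing pL = let (p⊑y , p⊑b) = to L-pair pL
    in from L-∪-sing (below-member⇒L-U pair-right p⊑y , p⊑b)

  greatest-L-U-pair-∪-sing-≥ : ∀ {a y b e} → a ⊑ b →
                               IsGreatest (L (U (pair a y) ∪ sing b)) e → a ⊑ e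
  greatest-L-U-pair-∪-sing-≥ a⊑b (_ , eMax) =
    eMax _ (from L-∪-sing (below-member⇒L-U pair-left refl , a⊑b))

  smallest⊑greatest : ∀ {a y b e f} → a ⊑ b →
                      IsGreatest (L (U (pair a y) ∪ sing b)) e →
                      IsSmallest (U (sing a ∪ L (pair y b))) f → f ⊑ e
  smallest⊑greatest a⊑b eG@(_ , eMax) (_ , fMin) =
    fMin _ (from U-sing-∪ ( greatest-L-U-pair-∪-sing-≥ a⊑b eG
                          , λ q → eMax q ∘ L-pair⊆L-U-pair-∪-sing))

  L-pair≐L-sing-lower : ∀ {a x z w} → w ⊑ z → a ⊑ x → a ⊑ w →
                        L (pair x z) ≐ L (sing a) → L (pair x w) ≐ L (sing a)
  L-pair≐L-sing-lower w⊑z a⊑x a⊑w meet = ⇔⇒≐ λ p → mk⇔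
    (λ pL → let (p⊑x , p⊑w) = to L-pair pL
            in proj₁ (meet p) (from L-pair (p⊑x , trans p⊑w w⊑z)))
    (λ pL → let p⊑a = to L-sing pL in from L-pair (trans p⊑a a⊑x , trans p⊑a a⊑w))

  U-pair≐U-sing-raise : ∀ {b x z w} → z ⊑ w → x ⊑ b → w ⊑ b →
                        U (pair x z) ≐ U (sing b) → U (pair x w) ≐ U (sing b)
  U-pair≐U-sing-raise z⊑w x⊑b w⊑b join = ⇔⇒≐ λ p → mk⇔
    (λ pU → let (x⊑p , w⊑p) = to U-pair pU
            in proj₁ (join p) (from U-pair (x⊑p , trans z⊑w w⊑p)))
    (λ pU → let b⊑p = to U-sing pU in from U-pair (trans x⊑b b⊑p , trans w⊑b b⊑p))

  relative-complements⇔meet×join : ∀ {a b x e f} →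
    a ⊑ x → x ⊑ b → a ⊑ f → f ⊑ e → e ⊑ b →
    (R a b x e × R a b x f) ⇔ (L (pair x e) ≐ L (sing a) × U (pair x f) ≐ U (sing b))
  relative-complements⇔meet×join a⊑x x⊑b a⊑f f⊑e e⊑b = mk⇔
    (λ ((_ , _ , meet-xe) , (_ , join-xf , _)) → meet-xe , join-xf)
    (λ (meet-xe , join-xf) →
        ((trans a⊑f f⊑e , e⊑b) , U-pair≐U-sing-raise f⊑e x⊑b e⊑b join-xf , meet-xe)
      , ((a⊑f , trans f⊑e e⊑b) , join-xf , L-pair≐L-sing-lower f⊑e a⊑x a⊑f meet-xe))

open Poset using (Carrier; _≤_)
open PosetNotions

theorem4 : {c ℓ₁ ℓ₂ : Level} (P : Poset c ℓ₁ ℓ₂) →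
    (a b x y e f : Carrier P) →
    _≤_ P a b → InInterval P a b x →
    IsGreatest P (L P (_∪_ P (U P (pair P a y)) (sing P b))) e →
    IsSmallest P (U P (_∪_ P (sing P a) (L P (pair P y b)))) f →
    (_≤_ P a f × _≤_ P f e × _≤_ P e b) ×
    ((R P a b x e × R P a b x f) ⇔
    (_≐_ P (L P (_∪_ P (U P (pair P a y)) (sing P x))) (L P (sing P a)) ×
    _≐_ P (U P (_∪_ P (sing P x) (L P (pair P y b)))) (U P (sing P b))))
theorem4 P a b x y e f a≤b (a≤x , x≤b) eG fS =
  (a≤f , f≤e , e≤b) ,
  ⇔.trans (relative-complements⇔meet×join a≤x x≤b a≤f f≤e e≤b)
          (≐-substˡ (≐-sym (L-∪-sing≐L-pair eG x≤b)) ×-⇔ ≐-substˡ (≐-sym (U-sing-∪≐U-pair fS a≤x)))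
  where
    open Cones P
    a≤f : _≤_ P a f
    a≤f = smallest-U-sing-∪-≥ fS
    f≤e : _≤_ P f e
    f≤e = smallest⊑greatest a≤b eG fS
    e≤b : _≤_ P e b
    e≤b = greatest-L-∪-sing-≤ eG
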